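{- For an integer $n \geq 1$ let $X_n = \{1, 2, \ldots, n\}$ and $maxSum(n) = \frac{n(n+1)}{2}$. For integers $S$ and $e$, let $SD[n][S]$ denote the number of subsets $A \subseteq X_n$ with $\sum_{a \in A} a = S$, and let $ED[n][S][e]$ denote the number of subsets $A \subseteq X_n$ with $\sum_{a \in A} a = S$ and $e \in A$. If $S$ is an integer with $\frac{n(n-1)}{2} + 1 \leq S \leq \frac{n(n+1)}{2}$ and $e$ is an integer with $1 \leq e < n$, then $$ED[n][S][e] = SD[n][S] - ED[n][maxSum(n) - S][e].$$
   Context: Subsets include the empty set, whose sum is taken to be $0$. -}

module Defs where

open import Data.Nat as ℕ using (ℕ; zero; suc)
open import Data.Integer as ℤ using (ℤ; +_)
open import Data.Fin using (Fin; toℕ)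
import Data.Fin.Properties
import Data.List
open import Data.Fin.Subset using (Subset; _∈_)
open import Data.Fin.Subset.Properties using (_∈?_)
open import Data.Bool using (Bool; true; false)
open import Data.Vec using (Vec; []; _∷_)
open import Data.List using (List; []; _∷_; _++_; map; length; filter; sum; allFin)
open import Data.Product using (∃; _×_; _,_)
open import Relation.Nullary using (Dec; yes; no; ¬_)
open import Relation.Nullary.Decidable using (_×-dec_)
open import Relation.Binary.PropositionalEquality using (_≡_)

-- A subset A of X_n = {1,…,n} is represented as  Subset n  (a Vec Bool n):
-- position i : Fin n stands for the element  toℕ i + 1  of X_n.

allSubsets : (n : ℕ) → List (Subset n)
allSubsets zero = [] ∷ []
allSubsets (suc n) = map (false ∷_) (allSubsets n) ++ map (true ∷_) (allSubsets n)

elt : {n : ℕ} → Fin n → ℤ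
elt i = + suc (toℕ i)

contrib : {n : ℕ} → Subset n → Fin n → ℤ
contrib A i with i ∈? A
... | yes _ = elt i
... | no _ = + 0

elemSum : {n : ℕ} → Subset n → ℤ
elemSum {n} A = Data.List.foldr ℤ._+_ (+ 0) (map (contrib A) (allFin n))

_∈X_ : {n : ℕ} → ℤ → Subset n → Set
_∈X_ {n} e A = ∃ λ (i : Fin n) → (elt i ≡ e) × (i ∈ A)

_∈X?_ : {n : ℕ} → (e : ℤ) → (A : Subset n) → Dec (e ∈X A)
_∈X?_ {n} e A = Data.Fin.Properties.any? (λ i → (elt i ℤ.≟ e) ×-dec (i ∈? A))

SD : (n : ℕ) → ℤ → ℕ
SD n S = length (filter (λ A → elemSum A ℤ.≟ S) (allSubsets n))

ED : (n : ℕ) → ℤ → ℤ → ℕ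
ED n S e = length (filter (λ A → (elemSum A ℤ.≟ S) ×-dec (e ∈X? A)) (allSubsets n))

maxSum : ℕ → ℕ
maxSum n = (n ℕ.* suc n) ℕ./ 2

-- Complementation A ↦ X_n ∖ A maps subsets of sum S onto subsets of sum
-- maxSum(n) − S, and swaps "e ∈ A" with "e ∉ A". Splitting the subsets of sum S
-- according to whether they contain e therefore gives
--   SD[n][S] = ED[n][S][e] + ED[n][maxSum(n) − S][e].
module Submission where

open import Defs
open import Data.Nat as ℕ using (ℕ; suc)
open import Data.Integer as ℤ using (ℤ; +_)
open import Relation.Binary.PropositionalEquality
  using (_≡_; refl; sym; trans; cong; cong₂; subst; module ≡-Reasoning)

open import Algebra.Core using (Op₂)
import Algebra.Properties.CommutativeMonoid.Sum as CommutativeMonoidSum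
open import Data.Bool using (true; false)
open import Data.Fin using (Fin; toℕ; fromℕ<; inject₁; fromℕ)
import Data.Fin.Properties as Fin
open import Data.Fin.Subset using (Subset; _∈_; ∁)
open import Data.Fin.Subset.Properties
  using (_∈?_; x∈p⇒x∉∁p; x∈∁p⇒x∉p; x∉p⇒x∈∁p; x∉∁p⇒x∈p)
open import Data.Integer.Tactic.RingSolver using (solve-∀)
import Data.Integer.Properties as ℤ
open import Data.List using (List; []; _∷_; _++_; map; length; filter; foldr; tabulate)
open import Data.List.Properties using (filter-++; length-++; filter-≐; map-tabulate)
open import Data.Nat.DivMod using (m*n/n≡m)
import Data.Nat.Properties as ℕ
import Data.Nat.Tactic.RingSolver as ℕ-Solver
open import Data.Product using (_×_; _,_; proj₁; proj₂)
open import Data.Vec using ([]; _∷_)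
import Data.Vec.Functional as Vector
open import Function using (_∘_)
open import Relation.Nullary using (yes; no; ¬_)
open import Relation.Nullary.Negation using (contradiction)
open import Relation.Unary using (Pred; Decidable; _≐_)
open import Relation.Unary.Properties using (_∩?_; ∁?)

open ≡-Reasoning

module ℕΣ = CommutativeMonoidSum ℕ.+-0-commutativeMonoid
module ℤΣ = CommutativeMonoidSum ℤ.+-0-commutativeMonoid

module _ {a p q} {A : Set a} {P : Pred A p} {Q : Pred A q}
         (P? : Decidable P) (Q? : Decidable Q) where

  length-filter-∩-∁ : ∀ xs → length (filter P? xs) ≡
    length (filter (P? ∩? Q?) xs) ℕ.+ length (filter (P? ∩? ∁? Q?) xs)
  length-filter-∩-∁ [] = refl
  length-filter-∩-∁ (x ∷ xs) with P? x | Q? x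
  ... | yes _ | yes _ = cong suc (length-filter-∩-∁ xs)
  ... | yes _ | no _ = trans (cong suc (length-filter-∩-∁ xs)) (sym (ℕ.+-suc _ _))
  ... | no _ | _ = length-filter-∩-∁ xs

length-filter-map : ∀ {a b p} {A : Set a} {B : Set b} {P : Pred B p}
  (P? : Decidable P) (f : A → B) xs →
  length (filter P? (map f xs)) ≡ length (filter (P? ∘ f) xs)
length-filter-map P? f [] = refl
length-filter-map P? f (x ∷ xs) with P? (f x)
... | yes _ = cong suc (length-filter-map P? f xs)
... | no _ = length-filter-map P? f xs

length-filter-allSubsets-∁ : ∀ {p} n {P : Pred (Subset n) p} (P? : Decidable P) →
  length (filter P? (allSubsets n)) ≡ length (filter (P? ∘ ∁) (allSubsets n))
length-filter-allSubsets-∁ ℕ.zero P? with P? []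
... | yes _ = refl
... | no _ = refl
length-filter-allSubsets-∁ (suc n) P? = begin
    length (filter P? (map (false ∷_) L ++ map (true ∷_) L))
  ≡⟨ length-filter-halves P? ⟩
    length (filter (P? ∘ (false ∷_)) L) ℕ.+ length (filter (P? ∘ (true ∷_)) L)
  ≡⟨ ℕ.+-comm (length (filter (P? ∘ (false ∷_)) L)) _ ⟩
    length (filter (P? ∘ (true ∷_)) L) ℕ.+ length (filter (P? ∘ (false ∷_)) L)
  ≡⟨ cong₂ ℕ._+_ (length-filter-allSubsets-∁ n _) (length-filter-allSubsets-∁ n _) ⟩
    length (filter (P? ∘ ∁ ∘ (false ∷_)) L) ℕ.+ length (filter (P? ∘ ∁ ∘ (true ∷_)) L)
  ≡⟨ sym (length-filter-halves (P? ∘ ∁)) ⟩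
    length (filter (P? ∘ ∁) (map (false ∷_) L ++ map (true ∷_) L))
  ∎
  where
  L : List (Subset n)
  L = allSubsets n
  length-filter-halves : ∀ {q} {Q : Pred (Subset (suc n)) q} (Q? : Decidable Q) →
    length (filter Q? (map (false ∷_) L ++ map (true ∷_) L)) ≡
    length (filter (Q? ∘ (false ∷_)) L) ℕ.+ length (filter (Q? ∘ (true ∷_)) L)
  length-filter-halves Q? = begin
      length (filter Q? (map (false ∷_) L ++ map (true ∷_) L))
    ≡⟨ cong length (filter-++ Q? (map (false ∷_) L) (map (true ∷_) L)) ⟩
      length (filter Q? (map (false ∷_) L) ++ filter Q? (map (true ∷_) L))
    ≡⟨ length-++ (filter Q? (map (false ∷_) L)) ⟩
      length (filter Q? (map (false ∷_) L)) ℕ.+ length (filter Q? (map (true ∷_) L))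
    ≡⟨ cong₂ ℕ._+_ (length-filter-map Q? _ L) (length-filter-map Q? _ L) ⟩
      length (filter (Q? ∘ (false ∷_)) L) ℕ.+ length (filter (Q? ∘ (true ∷_)) L)
    ∎

foldr-tabulate : ∀ {a} {A : Set a} (_⊕_ : Op₂ A) (ε : A) {n} (f : Fin n → A) →
  foldr _⊕_ ε (tabulate f) ≡ Vector.foldr _⊕_ ε f
foldr-tabulate _⊕_ ε {ℕ.zero} f = refl
foldr-tabulate _⊕_ ε {suc n} f = cong (f Fin.zero ⊕_) (foldr-tabulate _⊕_ ε (f ∘ Fin.suc))

sum-pos-commute : ∀ {n} (f : Fin n → ℕ) → ℤΣ.sum (+_ ∘ f) ≡ + ℕΣ.sum f
sum-pos-commute {ℕ.zero} f = refl
sum-pos-commute {suc n} f = trans (cong (ℤ._+_ (+ f Fin.zero)) (sum-pos-commute (f ∘ Fin.suc)))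
                                  (sym (ℤ.pos-+ (f Fin.zero) _))

sum[1+i]*2≡n*[1+n] : ∀ n → ℕΣ.sum (suc ∘ toℕ {n}) ℕ.* 2 ≡ n ℕ.* suc n
sum[1+i]*2≡n*[1+n] ℕ.zero = refl
sum[1+i]*2≡n*[1+n] (suc n) = begin
    ℕΣ.sum (suc ∘ toℕ {suc n}) ℕ.* 2
  ≡⟨ cong (ℕ._* 2) (ℕΣ.sum-init-last {n} (suc ∘ toℕ)) ⟩
    (ℕΣ.sum {n} (suc ∘ toℕ ∘ inject₁) ℕ.+ suc (toℕ (fromℕ n))) ℕ.* 2
  ≡⟨ cong₂ (λ s m → (s ℕ.+ suc m) ℕ.* 2)
       (ℕΣ.sum-cong-≗ {n} (cong suc ∘ Fin.toℕ-inject₁)) (Fin.toℕ-fromℕ n) ⟩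
    (ℕΣ.sum (suc ∘ toℕ {n}) ℕ.+ suc n) ℕ.* 2
  ≡⟨ ℕ.*-distribʳ-+ 2 (ℕΣ.sum (suc ∘ toℕ {n})) (suc n) ⟩
    ℕΣ.sum (suc ∘ toℕ {n}) ℕ.* 2 ℕ.+ suc n ℕ.* 2
  ≡⟨ cong (ℕ._+ suc n ℕ.* 2) (sum[1+i]*2≡n*[1+n] n) ⟩
    n ℕ.* suc n ℕ.+ suc n ℕ.* 2
  ≡⟨ n[1+n]+[1+n]2≡[1+n][2+n] n ⟩
    suc n ℕ.* suc (suc n)
  ∎
  where
  n[1+n]+[1+n]2≡[1+n][2+n] : ∀ n → n ℕ.* suc n ℕ.+ suc n ℕ.* 2 ≡ suc n ℕ.* suc (suc n)
  n[1+n]+[1+n]2≡[1+n][2+n] = ℕ-Solver.solve-∀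

sum-elt≡maxSum : ∀ n → ℤΣ.sum (elt {n}) ≡ + maxSum n
sum-elt≡maxSum n = begin
    ℤΣ.sum (elt {n})
  ≡⟨ sum-pos-commute {n} (suc ∘ toℕ) ⟩
    + ℕΣ.sum (suc ∘ toℕ {n})
  ≡⟨ cong +_ (sym (m*n/n≡m (ℕΣ.sum (suc ∘ toℕ {n})) 2)) ⟩
    + (ℕΣ.sum (suc ∘ toℕ {n}) ℕ.* 2 ℕ./ 2)
  ≡⟨ cong (λ m → + (m ℕ./ 2)) (sum[1+i]*2≡n*[1+n] n) ⟩
    + maxSum n
  ∎

elemSum≡sum-contrib : ∀ {n} (A : Subset n) → elemSum A ≡ ℤΣ.sum (contrib A)
elemSum≡sum-contrib A = begin
    foldr ℤ._+_ (+ 0) (map (contrib A) (tabulate (λ i → i)))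
  ≡⟨ cong (foldr ℤ._+_ (+ 0)) (map-tabulate (λ i → i) (contrib A)) ⟩
    foldr ℤ._+_ (+ 0) (tabulate (contrib A))
  ≡⟨ foldr-tabulate ℤ._+_ (+ 0) (contrib A) ⟩
    ℤΣ.sum (contrib A)
  ∎

contrib+contrib-∁ : ∀ {n} (A : Subset n) i → contrib A i ℤ.+ contrib (∁ A) i ≡ elt i
contrib+contrib-∁ A i with i ∈? A | i ∈? ∁ A
... | yes i∈A | yes i∈∁A = contradiction i∈A (x∈∁p⇒x∉p i∈∁A)
... | yes _   | no _     = ℤ.+-identityʳ (elt i)
... | no _    | yes _    = ℤ.+-identityˡ (elt i)
... | no i∉A  | no i∉∁A  = contradiction (x∉p⇒x∈∁p i∉A) i∉∁A

elemSum+elemSum-∁ : ∀ {n} (A : Subset n) → elemSum A ℤ.+ elemSum (∁ A) ≡ + maxSum n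
elemSum+elemSum-∁ {n} A = begin
    elemSum A ℤ.+ elemSum (∁ A)
  ≡⟨ cong₂ ℤ._+_ (elemSum≡sum-contrib A) (elemSum≡sum-contrib (∁ A)) ⟩
    ℤΣ.sum (contrib A) ℤ.+ ℤΣ.sum (contrib (∁ A))
  ≡⟨ sym (ℤΣ.∑-distrib-+ (contrib A) (contrib (∁ A))) ⟩
    ℤΣ.sum (λ i → contrib A i ℤ.+ contrib (∁ A) i)
  ≡⟨ ℤΣ.sum-cong-≗ {n} (contrib+contrib-∁ A) ⟩
    ℤΣ.sum (elt {n})
  ≡⟨ sum-elt≡maxSum n ⟩
    + maxSum n
  ∎

elemSum-∁ : ∀ {n} (A : Subset n) → elemSum (∁ A) ≡ + maxSum n ℤ.- elemSum A
elemSum-∁ A = trans (y≡[x+y]-x (elemSum A) (elemSum (∁ A)))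
                    (cong (ℤ._- elemSum A) (elemSum+elemSum-∁ A))
  where
  y≡[x+y]-x : ∀ x y → y ≡ (x ℤ.+ y) ℤ.- x
  y≡[x+y]-x = solve-∀

elt-injective : ∀ {n} {i j : Fin n} → elt i ≡ elt j → i ≡ j
elt-injective = Fin.toℕ-injective ∘ ℕ.suc-injective ∘ ℤ.+-injective

∈⇒elt∈X : ∀ {n} {i : Fin n} {A : Subset n} → i ∈ A → elt i ∈X A
∈⇒elt∈X i∈A = _ , refl , i∈A

elt∈X⇒∈ : ∀ {n} {i : Fin n} {A : Subset n} → elt i ∈X A → i ∈ A
elt∈X⇒∈ {A = A} (j , eltj≡elti , j∈A) = subst (_∈ A) (elt-injective eltj≡elti) j∈A

elt∉X∁⇔elt∈X : ∀ {n} (i : Fin n) → (λ A → ¬ elt i ∈X ∁ A) ≐ (λ A → elt i ∈X A)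
elt∉X∁⇔elt∈X i = ∈⇒elt∈X ∘ x∉∁p⇒x∈p ∘ (_∘ ∈⇒elt∈X)
              , λ e∈A → x∈p⇒x∉∁p (elt∈X⇒∈ e∈A) ∘ elt∈X⇒∈

elemSum-∁≡⇔elemSum≡ : ∀ {n} (S : ℤ) →
  (λ (A : Subset n) → elemSum (∁ A) ≡ S) ≐ (λ A → elemSum A ≡ + maxSum n ℤ.- S)
elemSum-∁≡⇔elemSum≡ {n} S =
    (λ {A} eq → trans (x≡M-[M-x] M (elemSum A)) (cong (ℤ._-_ M) (trans (sym (elemSum-∁ A)) eq)))
  , (λ {A} eq → trans (elemSum-∁ A) (trans (cong (ℤ._-_ M) eq) (sym (x≡M-[M-x] M S))))
  where
  M : ℤ
  M = + maxSum n
  x≡M-[M-x] : ∀ M x → x ≡ M ℤ.- (M ℤ.- x)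
  x≡M-[M-x] = solve-∀

SD≡ED+ED-complement : ∀ n (i : Fin n) (S : ℤ) →
  SD n S ≡ ED n S (elt i) ℕ.+ ED n (+ maxSum n ℤ.- S) (elt i)
SD≡ED+ED-complement n i S = begin
    SD n S
  ≡⟨ length-filter-∩-∁ (sum≟ S) e∈? L ⟩
    ED n S e ℕ.+ length (filter (sum≟ S ∩? ∁? e∈?) L)
  ≡⟨ cong (ED n S e ℕ.+_) (length-filter-allSubsets-∁ n (sum≟ S ∩? ∁? e∈?)) ⟩
    ED n S e ℕ.+ length (filter ((sum≟ S ∩? ∁? e∈?) ∘ ∁) L)
  ≡⟨ cong (λ xs → ED n S e ℕ.+ length xs) (filter-≐ _ (sum≟ S' ∩? e∈?) complement-swaps L) ⟩
    ED n S e ℕ.+ ED n S' e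
  ∎
  where
  L : List (Subset n)
  L = allSubsets n
  e S' : ℤ
  e = elt i
  S' = + maxSum n ℤ.- S
  sum≟ : ∀ T → Decidable (λ (A : Subset n) → elemSum A ≡ T)
  sum≟ T A = elemSum A ℤ.≟ T
  e∈? : Decidable (λ (A : Subset n) → e ∈X A)
  e∈? A = e ∈X? A
  complement-swaps : (λ A → elemSum (∁ A) ≡ S × ¬ e ∈X ∁ A) ≐ (λ A → elemSum A ≡ S' × e ∈X A)
  complement-swaps =
      (λ (s , m) → proj₁ (elemSum-∁≡⇔elemSum≡ {n} S) s , proj₁ (elt∉X∁⇔elt∈X i) m)
    , (λ (s , m) → proj₂ (elemSum-∁≡⇔elemSum≡ {n} S) s , proj₂ (elt∉X∁⇔elt∈X i) m)

theorem4 : (n : ℕ) → 1 ℕ.≤ n → (S e : ℤ)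
    → + ((n ℕ.* (n ℕ.∸ 1)) ℕ./ 2) ℤ.+ + 1 ℤ.≤ S → S ℤ.≤ + maxSum n
    → + 1 ℤ.≤ e → e ℤ.< + n
    → + ED n S e ≡ + SD n S ℤ.- + ED n (+ maxSum n ℤ.- S) e
theorem4 n _ S (+ ℕ.zero) _ _ (ℤ.+≤+ ()) _
theorem4 n _ S (+ suc k) _ _ _ (ℤ.+<+ 1+k<n) = begin
    + ED n S e
  ≡⟨ x≡[x+y]-y (+ ED n S e) (+ ED n S' e) ⟩
    (+ ED n S e ℤ.+ + ED n S' e) ℤ.- + ED n S' e
  ≡⟨ cong (ℤ._- + ED n S' e) (sym (ℤ.pos-+ (ED n S e) (ED n S' e))) ⟩
    + (ED n S e ℕ.+ ED n S' e) ℤ.- + ED n S' e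
  ≡⟨ cong (λ m → + m ℤ.- + ED n S' e) (sym SD≡ED+ED') ⟩
    + SD n S ℤ.- + ED n S' e
  ∎
  where
  e S' : ℤ
  e = + suc k
  S' = + maxSum n ℤ.- S
  k<n : k ℕ.< n
  k<n = ℕ.<⇒≤ 1+k<n
  SD≡ED+ED' : SD n S ≡ ED n S e ℕ.+ ED n S' e
  SD≡ED+ED' = subst (λ e → SD n S ≡ ED n S e ℕ.+ ED n S' e)
    (cong (+_ ∘ suc) (Fin.toℕ-fromℕ< k<n)) (SD≡ED+ED-complement n (fromℕ< k<n) S)
  x≡[x+y]-y : ∀ x y → x ≡ (x ℤ.+ y) ℤ.- y
  x≡[x+y]-y = solve-∀
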